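{- If $D\in\mathcal{F}$, then for every $v_a\in H_a$ there is no arc $v_a\to b$, and for every $v_b\in H_b$ there is no arc $v_b\to a$.
   Context: An oriented graph is a loopless directed graph with no pair of opposite arcs. Strong diameter $2$: for every ordered pair of distinct vertices $(i,j)$ there is a directed path from $i$ to $j$ of length at most $2$. 2-connected: strong connectivity at least $2$. Paths are simple directed paths; internal vertices are those other than the endpoints. $\mathcal{F}$ is the set of 2-connected oriented graphs $D$ with strong diameter $2$ having six distinct vertices $p,q,a,b,c,r$ such that: arcs $p\to c$, $q\to c$, $q\to b$, $b\to r$, $a\to r$, $p\to a$ are present; every directed path from $p$ to $r$ contains $a$ or contains both $c$ and $b$; every directed path from $q$ to $r$ contains $b$ or contains both $c$ and $a$; every directed path from $c$ to $r$ contains $a$ or $b$. $H_a$ is the set of internal vertices of directed paths from $p$ to $a$ not using $c$; $H_b$ is the set of internal vertices of directed paths from $q$ to $b$ not using $c$. -}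

module Defs where

open import Data.Nat using (ℕ; _≤_)
open import Data.Fin using (Fin)
open import Data.List using (List; []; _∷_; length)
open import Data.List.Membership.Propositional using (_∈_; _∉_)
open import Data.List.Relation.Unary.Unique.Propositional using (Unique)
open import Data.Product using (Σ; _×_; ∃; ∃-syntax)
open import Data.Sum using (_⊎_)
open import Relation.Binary.PropositionalEquality using (_≡_; _≢_)
open import Relation.Nullary using (¬_)

Arcs : ℕ → Set₁
Arcs n = Fin n → Fin n → Set

module _ {n : ℕ} (A : Arcs n) where

  data Walk : Fin n → Fin n → List (Fin n) → Set where
    stop : ∀ {x} → Walk x x (x ∷ [])
    step : ∀ {x y z vs} → A x y → Walk y z vs → Walk x z (x ∷ vs)

  -- A (simple) directed path: a walk with no repeated vertex.
  -- Its length is (length vs - 1).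
  Path : Fin n → Fin n → List (Fin n) → Set
  Path x y vs = Walk x y vs × Unique vs

  Internal : Fin n → Fin n → List (Fin n) → Fin n → Set
  Internal x y vs v = v ∈ vs × v ≢ x × v ≢ y

  Oriented : Set
  Oriented = (∀ i → ¬ A i i) × (∀ i j → A i j → ¬ A j i)

  -- strong diameter 2 (a path of length ≤ 2 has at most 3 vertices)
  StrongDiam2 : Set
  StrongDiam2 = ∀ i j → i ≢ j → ∃[ vs ] (Path i j vs × length vs ≤ 3)

  -- strong connectivity at least 2: at least 3 vertices, D is strong,
  -- and D - w is strong for every vertex w.
  TwoConnected : Set
  TwoConnected =
    (3 ≤ n)
    × (∀ u v → ∃[ vs ] Path u v vs)
    × (∀ w u v → u ≢ w → v ≢ w → ∃[ vs ] (Path u v vs × w ∉ vs))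

  -- H_a : internal vertices of directed paths from p to a not using c
  -- (as a predicate on vertices)
  InH : Fin n → Fin n → Fin n → Fin n → Set
  InH p a c v = ∃[ vs ] (Path p a vs × c ∉ vs × Internal p a vs v)

Distinct6 : ∀ {n} → (p q a b c r : Fin n) → Set
Distinct6 p q a b c r =
  p ≢ q × p ≢ a × p ≢ b × p ≢ c × p ≢ r ×
  q ≢ a × q ≢ b × q ≢ c × q ≢ r ×
  a ≢ b × a ≢ c × a ≢ r ×
  b ≢ c × b ≢ r ×
  c ≢ r

-- The configuration defining membership of D in 𝓕 (for given witnesses).
Config : ∀ {n} → Arcs n → (p q a b c r : Fin n) → Set
Config A p q a b c r =
  Distinct6 p q a b c r
  × A p c × A q c × A q b × A b r × A a r × A p a
  × (∀ vs → Path A p r vs → a ∈ vs ⊎ (c ∈ vs × b ∈ vs))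
  × (∀ vs → Path A q r vs → b ∈ vs ⊎ (c ∈ vs × a ∈ vs))
  × (∀ vs → Path A c r vs → a ∈ vs ⊎ b ∈ vs)

-- A vertex v of H_a lies on a path from p to a that avoids c. An arc v → b
-- would let us follow that path up to v and continue v → b → r, giving a
-- walk, hence a path, from p to r that avoids both a and c; this contradicts
-- the condition on paths from p to r. For H_b exchange (p, a, b) with (q, b, a).
module Submission where

open import Defs
open import Data.Nat using (ℕ)
open import Data.Fin using (Fin; _≟_)
open import Data.Product using (_×_; _,_; ∃-syntax; proj₁)
open import Data.Sum using (_⊎_; inj₁; inj₂)
import Data.Sum as Sum
open import Data.Empty using (⊥-elim)
open import Data.List using ([]; _∷_; _++_)
open import Data.List.Relation.Unary.Any using (here; there)
open import Data.List.Relation.Unary.All using (_∷_; []) renaming (lookup to All-lookup)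
open import Data.List.Relation.Unary.All.Properties using (¬Any⇒All¬; All¬⇒¬Any)
import Data.List.Relation.Unary.All.Properties as All
open import Data.List.Relation.Unary.AllPairs using ([]; _∷_)
open import Data.List.Membership.Propositional using (_∈_; _∉_)
open import Data.List.Relation.Binary.Subset.Propositional using (_⊆_)
open import Data.List.Relation.Binary.Subset.Propositional.Properties
  using (⊆-refl; ⊆-trans; xs⊆x∷xs; ∷⁺ʳ; ++⁺ˡ)
open import Relation.Binary.PropositionalEquality using (_≢_; refl; ≢-sym)
open import Relation.Nullary using (¬_; yes; no)
open import Function using (_∘′_)

∉-++⁺ : ∀ {X : Set} {x : X} xs {ys} → x ∉ xs → x ∉ ys → x ∉ xs ++ ys
∉-++⁺ xs x∉xs x∉ys = All¬⇒¬Any (All.++⁺ (¬Any⇒All¬ xs x∉xs) (¬Any⇒All¬ _ x∉ys))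

module _ {n : ℕ} {A : Arcs n} where

  open import Data.List.Membership.DecPropositional (_≟_ {n}) using (_∈?_)

  target∈ : ∀ {x y vs} → Walk A x y vs → y ∈ vs
  target∈ stop       = here refl
  target∈ (step _ w) = there (target∈ w)

  _++ʷ_ : ∀ {x y z vs us} → Walk A x y vs → Walk A y z (y ∷ us) → Walk A x z (vs ++ us)
  stop     ++ʷ w′ = w′
  step e w ++ʷ w′ = step e (w ++ʷ w′)

  path-from : ∀ {x y z vs} → Path A z y vs → x ∈ vs → ∃[ ws ] (Path A x y ws × ws ⊆ vs)
  path-from (stop , u)         (here refl) = _ , (stop , u) , ⊆-refl
  path-from (step e w , u)     (here refl) = _ , (step e w , u) , ⊆-refl
  path-from (step _ w , _ ∷ u) (there x∈)  with path-from (w , u) x∈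
  ... | ws , p , ws⊆ = ws , p , ⊆-trans ws⊆ (xs⊆x∷xs _ _)

  walk⇒path : ∀ {x y vs} → Walk A x y vs → ∃[ ws ] (Path A x y ws × ws ⊆ vs)
  walk⇒path stop = _ , (stop , [] ∷ []) , ⊆-refl
  walk⇒path {x} (step e w) with walk⇒path w
  ... | ws , (w′ , u) , ws⊆ with x ∈? ws
  ...   | no x∉ws  = x ∷ ws , (step e w′ , ¬Any⇒All¬ ws x∉ws ∷ u) , ∷⁺ʳ x ws⊆
  ...   | yes x∈ws with path-from (w′ , u) x∈ws
  ...     | zs , p , zs⊆ = zs , p , ⊆-trans zs⊆ (⊆-trans ws⊆ (xs⊆x∷xs _ x))

  prefix : ∀ {x y v vs} → Path A x y vs → v ∈ vs → v ≢ y →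
           ∃[ ws ] (Walk A x v ws × ws ⊆ vs × y ∉ ws)
  prefix (stop , _) (here refl) v≢y = ⊥-elim (v≢y refl)
  prefix (step _ w , x∉ ∷ _) (here refl) _ =
    _ , stop , ∷⁺ʳ _ (λ ()) , All¬⇒¬Any (≢-sym (All-lookup x∉ (target∈ w)) ∷ [])
  prefix (step e w , x∉ ∷ u) (there v∈) v≢y with prefix (w , u) v∈ v≢y
  ... | ws , w′ , ws⊆ , y∉ws =
    _ , step e w′ , ∷⁺ʳ _ ws⊆ , All¬⇒¬Any (≢-sym (All-lookup x∉ (target∈ w)) ∷ ¬Any⇒All¬ ws y∉ws)

  reroute : ∀ {x y v m z vs} → Path A x y vs → v ∈ vs → v ≢ y → A v m → A m z →
            y ≢ m → y ≢ z → ∃[ zs ] (Path A x z zs × zs ⊆ vs ++ m ∷ z ∷ [] × y ∉ zs)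
  reroute p v∈ v≢y vm mz y≢m y≢z with prefix p v∈ v≢y
  ... | ws , w , ws⊆ , y∉ws with walk⇒path (w ++ʷ step vm (step mz stop))
  ... | zs , p′ , zs⊆ =
    zs , p′ , ⊆-trans zs⊆ (++⁺ˡ _ ws⊆) ,
    λ y∈zs → ∉-++⁺ ws y∉ws (All¬⇒¬Any (y≢m ∷ y≢z ∷ [])) (zs⊆ y∈zs)

  no-bypass-arc : ∀ {x y c v m z vs} → (∀ zs → Path A x z zs → y ∈ zs ⊎ c ∈ zs) →
                  Path A x y vs → c ∉ vs → v ∈ vs → v ≢ y → A m z →
                  y ≢ m → y ≢ z → c ≢ m → c ≢ z → ¬ A v m
  no-bypass-arc {vs = vs} meets p c∉vs v∈ v≢y mz y≢m y≢z c≢m c≢z vm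
    with reroute p v∈ v≢y vm mz y≢m y≢z
  ... | zs , p′ , zs⊆ , y∉zs with meets zs p′
  ...   | inj₁ y∈zs = y∉zs y∈zs
  ...   | inj₂ c∈zs = ∉-++⁺ vs c∉vs (All¬⇒¬Any (c≢m ∷ c≢z ∷ [])) (zs⊆ c∈zs)

proposition7 : ∀ {n} (A : Arcs n) → Oriented A → TwoConnected A → StrongDiam2 A →
    (p q a b c r : Fin n) → Config A p q a b c r →
    (∀ v → InH A p a c v → ¬ A v b) × (∀ v → InH A q b c v → ¬ A v a)
proposition7 A _ _ _ p q a b c r
  ((_ , _ , _ , _ , _ , _ , _ , _ , _ , a≢b , a≢c , a≢r , b≢c , b≢r , c≢r)
   , _ , _ , _ , br , ar , _ , p⇝r , q⇝r , _) =
  (λ { v (_ , path , c∉ , v∈ , _ , v≢a) →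
         no-bypass-arc (λ zs → Sum.map₂ proj₁ ∘′ p⇝r zs) path c∉ v∈ v≢a br
                       a≢b a≢r (≢-sym b≢c) c≢r })
  , (λ { v (_ , path , c∉ , v∈ , _ , v≢b) →
         no-bypass-arc (λ zs → Sum.map₂ proj₁ ∘′ q⇝r zs) path c∉ v∈ v≢b ar
                       (≢-sym a≢b) b≢r (≢-sym a≢c) c≢r })
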